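{- Let $\Gamma$ be a context such that $\vdash\Gamma\ \mathsf{ctx}$ is derivable and let $\Theta$ be the arity context induced by $\Sigma$ and $\Gamma$. Suppose that $\Pi y_1{:}A_1.\cdots\Pi y_n{:}A_n.A$ is a type associated with a term constant or variable by $\Sigma$ or $\Gamma$, or that $\Pi y_1{:}A_1.\cdots\Pi y_n{:}A_n.K$ is a kind associated with a type constant by $\Sigma$, where the $y_i$ are distinct variables. Then for $1\le i\le n$, $A_i$ and $\Pi y_i{:}A_i.\cdots\Pi y_n{:}A_n.A$ (respectively $\Pi y_i{:}A_i.\cdots\Pi y_n{:}A_n.K$) respect the arity context $\{y_1{:}A_1^-,\dots,y_{i-1}{:}A_{i-1}^-\}\oplus\Theta$. Further, $A$ (respectively $K$) respects $\{y_1{:}A_1^-,\dots,y_n{:}A_n^-\}\oplus\Theta$.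
   Context: Canonical LF syntax: kinds $K ::= \mathrm{Type}\mid\Pi x{:}A.K$; canonical types $A ::= P\mid\Pi x{:}A_1.A_2$; atomic types $P ::= a\mid P\,M$; canonical terms $M ::= R\mid\lambda x.M$; atomic terms $R ::= c\mid x\mid R\,M$; contexts $\Gamma ::= \cdot\mid\Gamma,x{:}A$. Arity types $\alpha ::= o\mid\alpha\to\alpha$; erasure $P^-=o$, $(\Pi x{:}A_1.A_2)^-=A_1^-\to A_2^-$. $\Sigma$ is a fixed LF signature assumed well-formed, and $\vdash\Gamma\ \mathsf{ctx}$ is the canonical LF context well-formedness judgement ($\vdash\cdot\ \mathsf{ctx}$; $\vdash\Gamma,x{:}A\ \mathsf{ctx}$ if $\vdash\Gamma\ \mathsf{ctx}$, $\Gamma\vdash A\ \mathsf{type}$ in canonical LF with hereditary substitution, and $x$ not free in $\Gamma$). Arity contexts are sets of unique assignments of arity types to variables and term constants; $\Theta_1\oplus\Theta_2$ is $\Theta_1$ plus the assignments of $\Theta_2$ to symbols not assigned by $\Theta_1$. Arity typing: $\Theta\vdash c\Rightarrow\alpha$ if $c{:}\alpha\in\Theta$; $\Theta\vdash x\Rightarrow\alpha$ if $x{:}\alpha\in\Theta$; $\Theta\vdash R\,M\Rightarrow\alpha$ if $\Theta\vdash R\Rightarrow\alpha'\to\alpha$ and $\Theta\vdash M\Leftarrow\alpha'$; $\Theta\vdash\lambda x.M\Leftarrow\alpha_1\to\alpha_2$ if $\{x{:}\alpha_1\}\oplus\Theta\vdash M\Leftarrow\alpha_2$; $\Theta\vdash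 R\Leftarrow o$ if $\Theta\vdash R\Rightarrow o$. A kind or type $E$ respects $\Theta$ if $E=\mathrm{Type}$, or $E$ is atomic and each term argument $M$ of $E$ satisfies $\Theta\vdash M\Leftarrow\alpha$ for some $\alpha$, or $E=\Pi x{:}A.E'$ with $A$ respecting $\Theta$ and $E'$ respecting $\{x{:}A^-\}\oplus\Theta$. The arity context induced by $\Sigma$ and $\Gamma$ contains $x{:}A^-$ for each $x{:}A\in\Gamma$ and $c{:}A^-$ for each $c{:}A\in\Sigma$. -}

module Defs where

-- Canonical LF (Harper–Licata / Southern–Nadathur style) with de Bruijn
-- indices for bound variables and context variables; constants are named by ℕ.

open import Data.Nat using (ℕ; zero; suc; _<_; _<ᵇ_; pred)
open import Data.Bool using (if_then_else_)
open import Data.List using (List; []; _∷_; map; take; drop; length; lookup)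
open import Data.List.Membership.Propositional using (_∈_)
open import Data.Product using (Σ; ∃; _×_; _,_)
open import Data.Unit using (⊤)
open import Relation.Nullary using (¬_)

mutual
  data Tm : Set where
    atm : Atm → Tm
    lam : Tm → Tm

  data Atm : Set where
    con : ℕ → Atm
    var : ℕ → Atm
    app : Atm → Tm → Atm

mutual
  -- canonical types  A ::= P | Πx:A1.A2   (x is de Bruijn index 0 in A2)
  data Ty : Set where
    base : ATy → Ty
    pi   : Ty → Ty → Ty

  data ATy : Set where
    tcon : ℕ → ATy
    tapp : ATy → Tm → ATy

data Kind : Set where
  type : Kind
  kpi  : Ty → Kind → Kind

data Ar : Set where
  o   : Ar
  _⇒_ : Ar → Ar → Ar

infixr 5 _⇒_

erase : Ty → Ar
erase (base _)  = o
erase (pi A B) = erase A ⇒ erase B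

mutual
  shTm : ℕ → Tm → Tm
  shTm c (atm R) = atm (shAtm c R)
  shTm c (lam M) = lam (shTm (suc c) M)

  shAtm : ℕ → Atm → Atm
  shAtm c (con k)   = con k
  shAtm c (var k)   = var (if k <ᵇ c then k else suc k)
  shAtm c (app R M) = app (shAtm c R) (shTm c M)

mutual
  shTy : ℕ → Ty → Ty
  shTy c (base P) = base (shATy c P)
  shTy c (pi A B) = pi (shTy c A) (shTy (suc c) B)

  shATy : ℕ → ATy → ATy
  shATy c (tcon a)   = tcon a
  shATy c (tapp P M) = tapp (shATy c P) (shTm c M)

-- Hereditary substitution [M/x]^α, as a relation (partial)

mutual
  data HSubTm (M : Tm) (x : ℕ) (α : Ar) : Tm → Tm → Set where
    hs-lam  : ∀ {N N'} → HSubTm (shTm 0 M) (suc x) α N N' →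
              HSubTm M x α (lam N) (lam N')
    hs-atm  : ∀ {R R'} → HSubRA M x α R R' → HSubTm M x α (atm R) (atm R')
    hs-head : ∀ {R N'} → HSubRH M x α R N' o → HSubTm M x α (atm R) N'

  -- head of R is not x: result atomic
  data HSubRA (M : Tm) (x : ℕ) (α : Ar) : Atm → Atm → Set where
    hr-con : ∀ {c} → HSubRA M x α (con c) (con c)
    hr-lt  : ∀ {y} → y < x → HSubRA M x α (var y) (var y)
    hr-gt  : ∀ {y} → x < y → HSubRA M x α (var y) (var (pred y))
    hr-app : ∀ {R R' N N'} → HSubRA M x α R R' → HSubTm M x α N N' →
             HSubRA M x α (app R N) (app R' N')

  -- head of R is x: result a canonical term together with its arity
  data HSubRH (M : Tm) (x : ℕ) (α : Ar) : Atm → Tm → Ar → Set where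
    hh-var : HSubRH M x α (var x) M α
    hh-app : ∀ {R N N' M1 M2 α1 α2} →
             HSubRH M x α R (lam M1) (α1 ⇒ α2) →
             HSubTm M x α N N' →
             HSubTm N' 0 α1 M1 M2 →
             HSubRH M x α (app R N) M2 α2

mutual
  data HSubTy (M : Tm) (x : ℕ) (α : Ar) : Ty → Ty → Set where
    ht-base : ∀ {P P'} → HSubATy M x α P P' → HSubTy M x α (base P) (base P')
    ht-pi   : ∀ {A A' B B'} → HSubTy M x α A A' →
              HSubTy (shTm 0 M) (suc x) α B B' →
              HSubTy M x α (pi A B) (pi A' B')

  data HSubATy (M : Tm) (x : ℕ) (α : Ar) : ATy → ATy → Set where
    hp-con : ∀ {a} → HSubATy M x α (tcon a) (tcon a)
    hp-app : ∀ {P P' N N'} → HSubATy M x α P P' → HSubTm M x α N N' →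
             HSubATy M x α (tapp P N) (tapp P' N')

data HSubK (M : Tm) (x : ℕ) (α : Ar) : Kind → Kind → Set where
  hk-type : HSubK M x α type type
  hk-pi   : ∀ {A A' K K'} → HSubTy M x α A A' →
            HSubK (shTm 0 M) (suc x) α K K' →
            HSubK M x α (kpi A K) (kpi A' K')

data Decl : Set where
  tyc : ℕ → Kind → Decl
  tmc : ℕ → Ty → Decl

-- most recent declaration first
Sig : Set
Sig = List Decl

-- most recent variable first (de Bruijn index 0)
Ctx : Set
Ctx = List Ty

-- x : A ∈ Γ, with A weakened to live in all of Γ
data _∋_∶_ : Ctx → ℕ → Ty → Set where
  here  : ∀ {Γ A} → (A ∷ Γ) ∋ 0 ∶ shTy 0 A
  there : ∀ {Γ A B k} → Γ ∋ k ∶ A → (B ∷ Γ) ∋ suc k ∶ shTy 0 A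

mutual
  data SynR (S : Sig) (Γ : Ctx) : Atm → Ty → Set where
    sr-con : ∀ {c A} → tmc c A ∈ S → SynR S Γ (con c) A
    sr-var : ∀ {k A} → Γ ∋ k ∶ A → SynR S Γ (var k) A
    sr-app : ∀ {R M A1 A2 A'} → SynR S Γ R (pi A1 A2) → ChkM S Γ M A1 →
             HSubTy M 0 (erase A1) A2 A' → SynR S Γ (app R M) A'

  data ChkM (S : Sig) (Γ : Ctx) : Tm → Ty → Set where
    cm-atm : ∀ {R P} → SynR S Γ R (base P) → ChkM S Γ (atm R) (base P)
    cm-lam : ∀ {M A1 A2} → ChkM S (A1 ∷ Γ) M A2 → ChkM S Γ (lam M) (pi A1 A2)

data SynP (S : Sig) (Γ : Ctx) : ATy → Kind → Set where
  sp-con : ∀ {a K} → tyc a K ∈ S → SynP S Γ (tcon a) K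
  sp-app : ∀ {P M A K K'} → SynP S Γ P (kpi A K) → ChkM S Γ M A →
           HSubK M 0 (erase A) K K' → SynP S Γ (tapp P M) K'

data WfTy (S : Sig) : Ctx → Ty → Set where
  wt-base : ∀ {Γ P} → SynP S Γ P type → WfTy S Γ (base P)
  wt-pi   : ∀ {Γ A B} → WfTy S Γ A → WfTy S (A ∷ Γ) B → WfTy S Γ (pi A B)

data WfK (S : Sig) : Ctx → Kind → Set where
  wk-type : ∀ {Γ} → WfK S Γ type
  wk-pi   : ∀ {Γ A K} → WfTy S Γ A → WfK S (A ∷ Γ) K → WfK S Γ (kpi A K)

-- ⊢ Γ ctx   (freshness of x is automatic with de Bruijn indices)
data WfCtx (S : Sig) : Ctx → Set where
  wc-nil  : WfCtx S []
  wc-cons : ∀ {Γ A} → WfCtx S Γ → WfTy S Γ A → WfCtx S (A ∷ Γ)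

data WfSig : Sig → Set where
  ws-nil : WfSig []
  ws-tm  : ∀ {S c A} → WfSig S → WfTy S [] A → ¬ (∃ λ B → tmc c B ∈ S) →
           WfSig (tmc c A ∷ S)
  ws-ty  : ∀ {S a K} → WfSig S → WfK S [] K → ¬ (∃ λ L → tyc a L ∈ S) →
           WfSig (tyc a K ∷ S)

record ArCtx : Set where
  constructor mkΘ
  field
    vars : List Ar          -- arity of de Bruijn variable k is the k-th entry
    cons : List (ℕ × Ar)

open ArCtx public

push : Ar → ArCtx → ArCtx
push α Θ = mkΘ (α ∷ vars Θ) (cons Θ)

pushes : List Ty → ArCtx → ArCtx
pushes []       Θ = Θ
pushes (A ∷ As) Θ = pushes As (push (erase A) Θ)

data _∋ᵃ_∶_ : List Ar → ℕ → Ar → Set where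
  here  : ∀ {αs α} → (α ∷ αs) ∋ᵃ 0 ∶ α
  there : ∀ {αs α β k} → αs ∋ᵃ k ∶ α → (β ∷ αs) ∋ᵃ suc k ∶ α

mutual
  data ASyn (Θ : ArCtx) : Atm → Ar → Set where
    as-con : ∀ {c α} → (c , α) ∈ cons Θ → ASyn Θ (con c) α
    as-var : ∀ {k α} → vars Θ ∋ᵃ k ∶ α → ASyn Θ (var k) α
    as-app : ∀ {R M α' α} → ASyn Θ R (α' ⇒ α) → AChk Θ M α' → ASyn Θ (app R M) α

  data AChk (Θ : ArCtx) : Tm → Ar → Set where
    ac-lam : ∀ {M α1 α2} → AChk (push α1 Θ) M α2 → AChk Θ (lam M) (α1 ⇒ α2)
    ac-atm : ∀ {R} → ASyn Θ R o → AChk Θ (atm R) o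

RespATy : ArCtx → ATy → Set
RespATy Θ (tcon a)   = ⊤
RespATy Θ (tapp P M) = RespATy Θ P × ∃ λ α → AChk Θ M α

RespTy : ArCtx → Ty → Set
RespTy Θ (base P) = RespATy Θ P
RespTy Θ (pi A B) = RespTy Θ A × RespTy (push (erase A) Θ) B

RespK : ArCtx → Kind → Set
RespK Θ type      = ⊤
RespK Θ (kpi A K) = RespTy Θ A × RespK (push (erase A) Θ) K

sigArities : Sig → List (ℕ × Ar)
sigArities []            = []
sigArities (tyc a K ∷ S) = sigArities S
sigArities (tmc c A ∷ S) = (c , erase A) ∷ sigArities S

induced : Sig → Ctx → ArCtx
induced S Γ = mkΘ (map erase Γ) (sigArities S)

piTel : List Ty → Ty → Ty
piTel []       A = A
piTel (B ∷ Bs) A = pi B (piTel Bs A)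

kpiTel : List Ty → Kind → Kind
kpiTel []       K = K
kpiTel (B ∷ Bs) K = kpi B (kpiTel Bs K)

module Submission where

-- Every type or kind that is well formed in canonical LF respects the arity
-- context induced by its signature and context: each term argument of an
-- atomic type is well typed there, and hence checks against the erasure of
-- its type, because hereditary substitution does not change erasures.
-- Entries of a well-formed signature or context are well formed (entries of
-- Γ after weakening, which preserves arity typing), and respecting a
-- Π-telescope unfolds binder by binder into the claims for every prefix.

open import Defs
open import Data.Bool using (true; false; if_then_else_)
open import Data.Fin using (Fin; toℕ)
import Data.Fin as Fin
open import Data.List using (List; []; _∷_; length; lookup; take; drop; map)
open import Data.List.Membership.Propositional using (_∈_)
open import Data.List.Relation.Binary.Subset.Propositional using (_⊆_)
open import Data.List.Relation.Unary.Any using (here; there)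
open import Data.Nat using (ℕ; suc; _<ᵇ_)
open import Data.Product using (∃; _×_; _,_)
open import Data.Sum using (_⊎_; inj₁; inj₂)
open import Data.Unit using (tt)
open import Function using (id)
open import Relation.Binary.PropositionalEquality using (_≡_; refl; subst)

erase-shTy : ∀ c A → erase (shTy c A) ≡ erase A
erase-shTy c (base P) = refl
erase-shTy c (pi A B) rewrite erase-shTy c A | erase-shTy (suc c) B = refl

erase-HSubTy : ∀ {M x α A A'} → HSubTy M x α A A' → erase A' ≡ erase A
erase-HSubTy (ht-base _)   = refl
erase-HSubTy (ht-pi h₁ h₂) rewrite erase-HSubTy h₁ | erase-HSubTy h₂ = refl

record _⊆ᵃ_ (Θ Θ' : ArCtx) : Set where
  field
    vars-⊆ : ∀ {k α} → vars Θ ∋ᵃ k ∶ α → vars Θ' ∋ᵃ k ∶ α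
    cons-⊆ : cons Θ ⊆ cons Θ'

open _⊆ᵃ_

push-⊆ᵃ : ∀ {Θ Θ'} α → Θ ⊆ᵃ Θ' → push α Θ ⊆ᵃ push α Θ'
push-⊆ᵃ α Θ⊆Θ' .vars-⊆ here      = here
push-⊆ᵃ α Θ⊆Θ' .vars-⊆ (there x) = there (vars-⊆ Θ⊆Θ' x)
push-⊆ᵃ α Θ⊆Θ' .cons-⊆           = cons-⊆ Θ⊆Θ'

mutual
  ASyn-⊆ᵃ : ∀ {Θ Θ' R α} → Θ ⊆ᵃ Θ' → ASyn Θ R α → ASyn Θ' R α
  ASyn-⊆ᵃ Θ⊆Θ' (as-con c)   = as-con (cons-⊆ Θ⊆Θ' c)
  ASyn-⊆ᵃ Θ⊆Θ' (as-var x)   = as-var (vars-⊆ Θ⊆Θ' x)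
  ASyn-⊆ᵃ Θ⊆Θ' (as-app r m) = as-app (ASyn-⊆ᵃ Θ⊆Θ' r) (AChk-⊆ᵃ Θ⊆Θ' m)

  AChk-⊆ᵃ : ∀ {Θ Θ' M α} → Θ ⊆ᵃ Θ' → AChk Θ M α → AChk Θ' M α
  AChk-⊆ᵃ Θ⊆Θ' (ac-lam m) = ac-lam (AChk-⊆ᵃ (push-⊆ᵃ _ Θ⊆Θ') m)
  AChk-⊆ᵃ Θ⊆Θ' (ac-atm r) = ac-atm (ASyn-⊆ᵃ Θ⊆Θ' r)

RespATy-⊆ᵃ : ∀ {Θ Θ'} → Θ ⊆ᵃ Θ' → ∀ P → RespATy Θ P → RespATy Θ' P
RespATy-⊆ᵃ Θ⊆Θ' (tcon a)   tt            = tt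
RespATy-⊆ᵃ Θ⊆Θ' (tapp P M) (rP , α , rM) = RespATy-⊆ᵃ Θ⊆Θ' P rP , α , AChk-⊆ᵃ Θ⊆Θ' rM

RespTy-⊆ᵃ : ∀ {Θ Θ'} → Θ ⊆ᵃ Θ' → ∀ A → RespTy Θ A → RespTy Θ' A
RespTy-⊆ᵃ Θ⊆Θ' (base P) rP        = RespATy-⊆ᵃ Θ⊆Θ' P rP
RespTy-⊆ᵃ Θ⊆Θ' (pi A B) (rA , rB) =
  RespTy-⊆ᵃ Θ⊆Θ' A rA , RespTy-⊆ᵃ (push-⊆ᵃ (erase A) Θ⊆Θ') B rB

RespK-⊆ᵃ : ∀ {Θ Θ'} → Θ ⊆ᵃ Θ' → ∀ K → RespK Θ K → RespK Θ' K
RespK-⊆ᵃ Θ⊆Θ' type      tt        = tt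
RespK-⊆ᵃ Θ⊆Θ' (kpi A K) (rA , rK) =
  RespTy-⊆ᵃ Θ⊆Θ' A rA , RespK-⊆ᵃ (push-⊆ᵃ (erase A) Θ⊆Θ') K rK

shiftIndex : ℕ → ℕ → ℕ
shiftIndex c k = if k <ᵇ c then k else suc k

record InsertsVarAt (c : ℕ) (Θ Θ' : ArCtx) : Set where
  field
    vars-shift : ∀ {k α} → vars Θ ∋ᵃ k ∶ α → vars Θ' ∋ᵃ shiftIndex c k ∶ α
    cons-⊆     : cons Θ ⊆ cons Θ'

open InsertsVarAt

suc-shiftIndex : ∀ c k → suc (shiftIndex c k) ≡ shiftIndex (suc c) (suc k)
suc-shiftIndex c k with k <ᵇ c
... | true  = refl
... | false = refl

push-InsertsVarAt : ∀ {c Θ Θ'} α → InsertsVarAt c Θ Θ' →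
                    InsertsVarAt (suc c) (push α Θ) (push α Θ')
push-InsertsVarAt α ins .vars-shift here                = here
push-InsertsVarAt {c} α ins .vars-shift (there {k = k} x) =
  subst (λ n → _ ∋ᵃ n ∶ _) (suc-shiftIndex c k) (there (vars-shift ins x))
push-InsertsVarAt α ins .cons-⊆                         = cons-⊆ ins

mutual
  ASyn-shift : ∀ {c Θ Θ' R α} → InsertsVarAt c Θ Θ' → ASyn Θ R α → ASyn Θ' (shAtm c R) α
  ASyn-shift ins (as-con x)   = as-con (cons-⊆ ins x)
  ASyn-shift ins (as-var x)   = as-var (vars-shift ins x)
  ASyn-shift ins (as-app r m) = as-app (ASyn-shift ins r) (AChk-shift ins m)

  AChk-shift : ∀ {c Θ Θ' M α} → InsertsVarAt c Θ Θ' → AChk Θ M α → AChk Θ' (shTm c M) α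
  AChk-shift ins (ac-lam m) = ac-lam (AChk-shift (push-InsertsVarAt _ ins) m)
  AChk-shift ins (ac-atm r) = ac-atm (ASyn-shift ins r)

RespATy-shift : ∀ {c Θ Θ'} → InsertsVarAt c Θ Θ' → ∀ P → RespATy Θ P → RespATy Θ' (shATy c P)
RespATy-shift ins (tcon a)   tt            = tt
RespATy-shift ins (tapp P M) (rP , α , rM) = RespATy-shift ins P rP , α , AChk-shift ins rM

RespTy-shift : ∀ {c Θ Θ'} → InsertsVarAt c Θ Θ' → ∀ A → RespTy Θ A → RespTy Θ' (shTy c A)
RespTy-shift ins (base P) rP = RespATy-shift ins P rP
RespTy-shift {c} ins (pi A B) (rA , rB) rewrite erase-shTy c A =
  RespTy-shift ins A rA , RespTy-shift (push-InsertsVarAt (erase A) ins) B rB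

tmc∈-sigArities : ∀ {S c A} → tmc c A ∈ S → (c , erase A) ∈ sigArities S
tmc∈-sigArities {tmc _ _ ∷ S} (here refl) = here refl
tmc∈-sigArities {tmc _ _ ∷ S} (there p)   = there (tmc∈-sigArities p)
tmc∈-sigArities {tyc _ _ ∷ S} (there p)   = tmc∈-sigArities p

∋-map-erase : ∀ {Γ k A} → Γ ∋ k ∶ A → map erase Γ ∋ᵃ k ∶ erase A
∋-map-erase (here {A = A})    rewrite erase-shTy 0 A = here
∋-map-erase (there {A = A} x) rewrite erase-shTy 0 A = there (∋-map-erase x)

mutual
  SynR⇒ASyn : ∀ {S Γ R A} → SynR S Γ R A → ASyn (induced S Γ) R (erase A)
  SynR⇒ASyn (sr-con c)     = as-con (tmc∈-sigArities c)
  SynR⇒ASyn (sr-var x)     = as-var (∋-map-erase x)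
  SynR⇒ASyn (sr-app r m h) rewrite erase-HSubTy h = as-app (SynR⇒ASyn r) (ChkM⇒AChk m)

  ChkM⇒AChk : ∀ {S Γ M A} → ChkM S Γ M A → AChk (induced S Γ) M (erase A)
  ChkM⇒AChk (cm-atm r) = ac-atm (SynR⇒ASyn r)
  ChkM⇒AChk (cm-lam m) = ac-lam (ChkM⇒AChk m)

SynP⇒RespATy : ∀ {S Γ P K} → SynP S Γ P K → RespATy (induced S Γ) P
SynP⇒RespATy (sp-con a)     = tt
SynP⇒RespATy (sp-app p m h) = SynP⇒RespATy p , _ , ChkM⇒AChk m

WfTy⇒RespTy : ∀ {S Γ A} → WfTy S Γ A → RespTy (induced S Γ) A
WfTy⇒RespTy (wt-base p)   = SynP⇒RespATy p
WfTy⇒RespTy (wt-pi wA wB) = WfTy⇒RespTy wA , WfTy⇒RespTy wB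

WfK⇒RespK : ∀ {S Γ K} → WfK S Γ K → RespK (induced S Γ) K
WfK⇒RespK wk-type       = tt
WfK⇒RespK (wk-pi wA wK) = WfTy⇒RespTy wA , WfK⇒RespK wK

induced-[]-⊆ᵃ : ∀ S S' Γ → sigArities S ⊆ sigArities S' → induced S [] ⊆ᵃ induced S' Γ
induced-[]-⊆ᵃ S S' Γ S⊆S' .vars-⊆ ()
induced-[]-⊆ᵃ S S' Γ S⊆S' .cons-⊆ = S⊆S'

WfSig-tmc-RespTy : ∀ {S} → WfSig S → ∀ {c A} → tmc c A ∈ S → RespTy (induced S []) A
WfSig-tmc-RespTy (ws-tm {S} {c} {A} wS wA _) (here refl) =
  RespTy-⊆ᵃ (induced-[]-⊆ᵃ S (tmc c A ∷ S) [] there) A (WfTy⇒RespTy wA)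
WfSig-tmc-RespTy (ws-tm {S} {c} {A} wS wA _) {A = B} (there p) =
  RespTy-⊆ᵃ (induced-[]-⊆ᵃ S (tmc c A ∷ S) [] there) B (WfSig-tmc-RespTy wS p)
WfSig-tmc-RespTy (ws-ty wS wK _) (there p) = WfSig-tmc-RespTy wS p

WfSig-tyc-RespK : ∀ {S} → WfSig S → ∀ {a K} → tyc a K ∈ S → RespK (induced S []) K
WfSig-tyc-RespK (ws-ty wS wK _) (here refl) = WfK⇒RespK wK
WfSig-tyc-RespK (ws-ty wS wK _) (there p)   = WfSig-tyc-RespK wS p
WfSig-tyc-RespK (ws-tm {S} {c} {A} wS wA _) {K = K} (there p) =
  RespK-⊆ᵃ (induced-[]-⊆ᵃ S (tmc c A ∷ S) [] there) K (WfSig-tyc-RespK wS p)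

induced-InsertsVarAt-0 : ∀ S Γ A → InsertsVarAt 0 (induced S Γ) (induced S (A ∷ Γ))
induced-InsertsVarAt-0 S Γ A .vars-shift = there
induced-InsertsVarAt-0 S Γ A .cons-⊆     = id

WfCtx-∋-RespTy : ∀ {S Γ} → WfCtx S Γ → ∀ {k A} → Γ ∋ k ∶ A → RespTy (induced S Γ) A
WfCtx-∋-RespTy {S} (wc-cons {Γ} wΓ wA) (here {A = A}) =
  RespTy-shift (induced-InsertsVarAt-0 S Γ A) A (WfTy⇒RespTy wA)
WfCtx-∋-RespTy {S} (wc-cons {Γ} {B} wΓ wB) (there {A = A} x) =
  RespTy-shift (induced-InsertsVarAt-0 S Γ B) A (WfCtx-∋-RespTy wΓ x)

module _ {X : Set} (RespX : ArCtx → X → Set) (tel : List Ty → X → X)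
         (unfold-[] : ∀ {Θ x} → RespX Θ (tel [] x) → RespX Θ x)
         (unfold-∷  : ∀ {Θ B Bs x} → RespX Θ (tel (B ∷ Bs) x) →
                      RespTy Θ B × RespX (push (erase B) Θ) (tel Bs x)) where

  respects-telescope : ∀ Θ As x → RespX Θ (tel As x) →
    ((i : Fin (length As)) →
        RespTy (pushes (take (toℕ i) As) Θ) (lookup As i)
      × RespX (pushes (take (toℕ i) As) Θ) (tel (drop (toℕ i) As) x))
    × RespX (pushes As Θ) x
  respects-telescope Θ []       x r = (λ ()) , unfold-[] r
  respects-telescope Θ (B ∷ Bs) x r with unfold-∷ r
  ... | rB , rBs with respects-telescope (push (erase B) Θ) Bs x rBs
  ...   | prefixes , body = (λ { Fin.zero → rB , r ; (Fin.suc i) → prefixes i }) , body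

lemma2p1 : (S : Sig) → WfSig S → (Γ : Ctx) → WfCtx S Γ →
    ((T : Ty) → ((∃ λ c → tmc c T ∈ S) ⊎ (∃ λ x → Γ ∋ x ∶ T)) →
      (As : List Ty) (A : Ty) → T ≡ piTel As A →
      ((i : Fin (length As)) →
          RespTy (pushes (take (toℕ i) As) (induced S Γ)) (lookup As i)
        × RespTy (pushes (take (toℕ i) As) (induced S Γ)) (piTel (drop (toℕ i) As) A))
      × RespTy (pushes As (induced S Γ)) A)
    × ((a : ℕ) (L : Kind) → tyc a L ∈ S →
      (As : List Ty) (K : Kind) → L ≡ kpiTel As K →
      ((i : Fin (length As)) →
          RespTy (pushes (take (toℕ i) As) (induced S Γ)) (lookup As i)
        × RespK (pushes (take (toℕ i) As) (induced S Γ)) (kpiTel (drop (toℕ i) As) K))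
      × RespK (pushes As (induced S Γ)) K)
lemma2p1 S wS Γ wΓ =
  (λ { T (inj₁ (c , c∈S)) As A refl →
         respects-telescope RespTy piTel id id (induced S Γ) As A
           (RespTy-⊆ᵃ sig⊆Γ T (WfSig-tmc-RespTy wS c∈S))
     ; T (inj₂ (x , x∈Γ)) As A refl →
         respects-telescope RespTy piTel id id (induced S Γ) As A
           (WfCtx-∋-RespTy wΓ x∈Γ) })
  , λ { a L a∈S As K refl →
          respects-telescope RespK kpiTel id id (induced S Γ) As K
            (RespK-⊆ᵃ sig⊆Γ L (WfSig-tyc-RespK wS a∈S)) }
  where
  sig⊆Γ : induced S [] ⊆ᵃ induced S Γ
  sig⊆Γ = induced-[]-⊆ᵃ S S Γ id
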